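{- Let $n\ge2$, $w\in\mathcal S_n$, and let $R$ be a standard balanced tableau on the Rothe diagram of $w$. Suppose $R$ has labels $i-1$ and $i$ in the cells $(z,y)$ and $(z,x)$ respectively, where $x<y<z$. Then $R$ does not have the label $i+1$ in a cell $(y',x)$ with $y'\neq y$.
   Context: For $w=w_1\cdots w_n\in\mathcal S_n$, the Rothe diagram $\mathbb D(w)$ is the set of cells $(p,q)$, indexed by pairs of values with $p>q$ and $p$ appearing before $q$ in $w$ (the inversions of $w$); its size is $\ell(w)$, the number of inversions. The cell $(p,q)$ lies in the row of $p$, placed at height $w^{ -1}(p)$ (the position of $p$ in $w$), and in column $q$ (columns ordered left to right by $q=1,\dots,n$). A standard balanced tableau on $\mathbb D(w)$ is a bijective labelling $R$ of the cells by $\{1,\dots,\ell(w)\}$ such that for each cell $(p,q)$, the number of cells $(p,q')$ in the same row to its right ($q'>q$) with $R(p,q')>R(p,q)$ equals the number of cells $(p',q)$ in the same column above it ($w^{ -1}(p')>w^{ -1}(p)$) with $R(p',q)<R(p,q)$. -}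

module Defs where

open import Data.Nat using (ℕ; suc; _≤_; _<_) renaming (_<?_ to _<ℕ?_)
open import Data.Fin using (Fin) renaming (_<_ to _<ᶠ_; _<?_ to _<ᶠ?_)
open import Data.Fin.Permutation using (Permutation′; _⟨$⟩ʳ_; _⟨$⟩ˡ_)
open import Data.Product using (_×_; _,_; proj₁; proj₂)
open import Data.List using (List; length; filter; allFin; cartesianProduct)
open import Relation.Nullary using (Dec)
open import Relation.Nullary.Decidable using (_×-dec_)
open import Relation.Binary.PropositionalEquality using (_≡_)

-- A permutation w ∈ S_n in one-line notation: w_i = w ⟨$⟩ʳ i (position i ↦ value).
-- pos w p = w⁻¹(p), the position of the value p in w.
pos : ∀ {n} → Permutation′ n → Fin n → Fin n
pos w p = w ⟨$⟩ˡ p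

-- (p , q) is a cell of the Rothe diagram 𝔻(w): p > q and p appears before q in w.
InD : ∀ {n} → Permutation′ n → Fin n → Fin n → Set
InD w p q = (q <ᶠ p) × (pos w p <ᶠ pos w q)

InD? : ∀ {n} (w : Permutation′ n) (p q : Fin n) → Dec (InD w p q)
InD? w p q = (q <ᶠ? p) ×-dec (pos w p <ᶠ? pos w q)

len : ∀ {n} → Permutation′ n → ℕ
len {n} w = length (filter (λ pq → InD? w (proj₁ pq) (proj₂ pq))
                           (cartesianProduct (allFin n) (allFin n)))

-- A labelling of cells (values outside 𝔻(w) are irrelevant).
Labelling : ℕ → Set
Labelling n = Fin n → Fin n → ℕ

armCount : ∀ {n} → Permutation′ n → Labelling n → Fin n → Fin n → ℕ
armCount {n} w R p q = length (filter
  (λ q' → (q <ᶠ? q') ×-dec (InD? w p q' ×-dec (R p q <ℕ? R p q')))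
  (allFin n))

legCount : ∀ {n} → Permutation′ n → Labelling n → Fin n → Fin n → ℕ
legCount {n} w R p q = length (filter
  (λ p' → (pos w p <ᶠ? pos w p') ×-dec (InD? w p' q ×-dec (R p' q <ℕ? R p q)))
  (allFin n))

-- R is a standard balanced tableau on 𝔻(w): a bijection from the cells onto
-- {1,…,ℓ(w)} (injective on cells with values in [1, ℓ(w)]; since there are
-- exactly ℓ(w) cells this is bijectivity), satisfying the balance condition.
record StandardBalanced {n} (w : Permutation′ n) (R : Labelling n) : Set where
  field
    range   : ∀ p q → InD w p q → 1 ≤ R p q × R p q ≤ len w
    inj     : ∀ p q p' q' → InD w p q → InD w p' q' → R p q ≡ R p' q' →
              (p ≡ p') × (q ≡ q')
    balance : ∀ p q → InD w p q → armCount w R p q ≡ legCount w R p q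

-- The cell (p , q) carrying the largest label of a balanced tableau has arm 0, hence leg 0, and
-- this forces p and q into adjacent positions of w.  Exchanging them removes exactly (p , q) from the
-- Rothe diagram and keeps the remaining labels balanced; the delicate point is the leg of a cell
-- (p , b) with b < q, which needs R q b < R p b, proved by downward induction on b.
-- Peel off every label above i + 2 in this way.  Then (y′ , x) is the top cell, so x sits right
-- after y′; after exchanging, (z , x) is on top and z moves to the old position of y′; after
-- exchanging again, (z , y) is on top, so y sits right after z, i.e. in the original position of x.
-- Since y ≠ y′, x, z, the position of y never moved, so y = x: a contradiction.

module Submission where

open import Defs
open import Data.Bool using (if_then_else_)
open import Data.Empty using (⊥)
open import Data.Fin using (Fin; toℕ; fromℕ<) renaming (_<_ to _<ᶠ_; _>_ to _>ᶠ_; _<?_ to _<ᶠ?_)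
import Data.Fin as Fin
open import Data.Fin.Induction using (>-wellFounded)
open import Data.Fin.Permutation using (Permutation′; _⟨$⟩ʳ_; inverseˡ; inverseʳ; transpose; _∘ₚ_)
import Data.Fin.Permutation.Components as PC
open import Data.Fin.Properties using (toℕ-injective; toℕ<n; toℕ-fromℕ<; any?)
  renaming (_≟_ to _≟ᶠ_; <-cmp to <ᶠ-cmp; <⇒≢ to <ᶠ⇒≢; suc-injective to Fin-suc-injective)
open import Data.List using (length; filter; tabulate)
open import Data.Nat using (ℕ; zero; suc; _+_; _≤_; _<_; z≤n; s≤s; _≟_) renaming (_<?_ to _<ℕ?_)
open import Data.Nat.Properties
  using (<-irrefl; <-asym; <-trans; ≤-trans; ≤-reflexive; <-≤-trans; ≤-<-trans; ≤∧≢⇒<; ≤-pred; ≮⇒≥;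
         <⇒≢; n≤1+n; n<1+n; m≤n⇒m≤1+n; m≤n⇒m<n∨m≡n; module ≤-Reasoning)
  renaming (suc-injective to ℕ-suc-injective)
open import Data.Product using (_×_; _,_; proj₁; proj₂)
open import Data.Sum using (inj₁; inj₂; [_,_])
open import Function using (_∘_)
open import Induction.WellFounded using (Acc; acc)
open import Level using (Level; 0ℓ)
open import Relation.Binary using (Tri; tri<; tri≈; tri>)
open import Relation.Binary.PropositionalEquality
  using (_≡_; _≢_; refl; sym; trans; cong; ≢-sym; subst; subst₂; module ≡-Reasoning)
open import Relation.Nullary using (¬_; Dec; does; yes; no; contradiction)
open import Relation.Nullary.Decidable using (_×-dec_; decidable-stable)
open import Relation.Unary using (Pred; Decidable; _⊆_; _≐_; _∪_; ｛_｝)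
open import Relation.Unary.Properties using (_∪?_)

private
  variable
    a ℓ ℓ′ : Level
    A : Set a
    n : ℕ

count : {P : Pred (Fin n) ℓ} → Decidable P → ℕ
count {zero}  P? = 0
count {suc n} P? = (if does (P? Fin.zero) then 1 else 0) + count (P? ∘ Fin.suc)

length-filter-tabulate : {P : Pred A ℓ} (P? : Decidable P) (f : Fin n → A) →
  length (filter P? (tabulate f)) ≡ count (P? ∘ f)
length-filter-tabulate {n = zero}  P? f = refl
length-filter-tabulate {n = suc n} P? f with P? (f Fin.zero)
... | yes _ = cong suc (length-filter-tabulate P? (f ∘ Fin.suc))
... | no  _ = length-filter-tabulate P? (f ∘ Fin.suc)

count-cong : {P : Pred (Fin n) ℓ} {Q : Pred (Fin n) ℓ′} (P? : Decidable P) (Q? : Decidable Q) →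
  P ≐ Q → count P? ≡ count Q?
count-cong {n = zero}  P? Q? _ = refl
count-cong {n = suc n} P? Q? (P⊆Q , Q⊆P) with P? Fin.zero | Q? Fin.zero
... | yes _ | yes _ = cong suc (count-cong (P? ∘ Fin.suc) (Q? ∘ Fin.suc) (P⊆Q , Q⊆P))
... | no  _ | no  _ = count-cong (P? ∘ Fin.suc) (Q? ∘ Fin.suc) (P⊆Q , Q⊆P)
... | yes p | no ¬q = contradiction (P⊆Q p) ¬q
... | no ¬p | yes q = contradiction (Q⊆P q) ¬p

count-mono : {P : Pred (Fin n) ℓ} {Q : Pred (Fin n) ℓ′} (P? : Decidable P) (Q? : Decidable Q) →
  P ⊆ Q → count P? ≤ count Q?
count-mono {n = zero}  P? Q? _ = z≤n
count-mono {n = suc n} P? Q? P⊆Q with P? Fin.zero | Q? Fin.zero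
... | yes _ | yes _ = s≤s (count-mono (P? ∘ Fin.suc) (Q? ∘ Fin.suc) P⊆Q)
... | no  _ | no  _ = count-mono (P? ∘ Fin.suc) (Q? ∘ Fin.suc) P⊆Q
... | no  _ | yes _ = m≤n⇒m≤1+n (count-mono (P? ∘ Fin.suc) (Q? ∘ Fin.suc) P⊆Q)
... | yes p | no ¬q = contradiction (P⊆Q p) ¬q

count-none : {P : Pred (Fin n) ℓ} (P? : Decidable P) → (∀ i → ¬ P i) → count P? ≡ 0
count-none {n = zero}  P? _ = refl
count-none {n = suc n} P? ¬P with P? Fin.zero
... | yes p = contradiction p (¬P Fin.zero)
... | no  _ = count-none (P? ∘ Fin.suc) (¬P ∘ Fin.suc)

count-some : {P : Pred (Fin n) ℓ} (P? : Decidable P) {j : Fin n} → P j → 0 < count P?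
count-some P? {Fin.zero} Pj with P? Fin.zero
... | yes _ = s≤s z≤n
... | no ¬p = contradiction Pj ¬p
count-some P? {Fin.suc j} Pj with P? Fin.zero
... | yes _ = s≤s z≤n
... | no  _ = count-some (P? ∘ Fin.suc) Pj

count-suc : {P : Pred (Fin n) ℓ} {Q : Pred (Fin n) ℓ′} (P? : Decidable P) (Q? : Decidable Q) {j : Fin n} →
  P ⊆ Q → Q j → ¬ P j → (∀ {i} → Q i → i ≢ j → P i) → count Q? ≡ suc (count P?)
count-suc P? Q? {Fin.zero} P⊆Q Qj ¬Pj Q⊆P with P? Fin.zero | Q? Fin.zero
... | yes p | _    = contradiction p ¬Pj
... | no  _ | no ¬q = contradiction Qj ¬q
... | no  _ | yes _ = cong suc (count-cong (Q? ∘ Fin.suc) (P? ∘ Fin.suc) ((λ q → Q⊆P q λ ()) , P⊆Q))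
count-suc P? Q? {Fin.suc j} P⊆Q Qj ¬Pj Q⊆P with P? Fin.zero | Q? Fin.zero
... | yes _ | yes _ =
  cong suc (count-suc (P? ∘ Fin.suc) (Q? ∘ Fin.suc) P⊆Q Qj ¬Pj λ q i≢j → Q⊆P q (i≢j ∘ Fin-suc-injective))
... | no  _ | no  _ =
  count-suc (P? ∘ Fin.suc) (Q? ∘ Fin.suc) P⊆Q Qj ¬Pj λ q i≢j → Q⊆P q (i≢j ∘ Fin-suc-injective)
... | yes p | no ¬q = contradiction (P⊆Q p) ¬q
... | no ¬p | yes q = contradiction (Q⊆P q λ ()) ¬p

count-< : {P : Pred (Fin n) ℓ} {Q : Pred (Fin n) ℓ′} (P? : Decidable P) (Q? : Decidable Q) {j : Fin n} →
  P ⊆ Q → Q j → ¬ P j → count P? < count Q?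
count-< {P = P} P? Q? {j} P⊆Q Qj ¬Pj = <-≤-trans
  (≤-reflexive (sym (count-suc P? (P? ∪? (j ≟ᶠ_)) inj₁ (inj₂ refl) ¬Pj P∪j⊆P)))
  (count-mono (P? ∪? (j ≟ᶠ_)) Q? [ P⊆Q , (λ { refl → Qj }) ])
  where
  P∪j⊆P : ∀ {i} → (P ∪ ｛ j ｝) i → i ≢ j → P i
  P∪j⊆P (inj₁ p)    _   = p
  P∪j⊆P (inj₂ refl) j≢j = contradiction refl j≢j

successor-< : {i j k : Fin n} → toℕ j ≡ suc (toℕ i) → i <ᶠ k → k ≢ j → j <ᶠ k
successor-< {k = k} j≡1+i i<k k≢j =
  ≤∧≢⇒< (subst (_≤ toℕ k) (sym j≡1+i) i<k) (λ e → k≢j (toℕ-injective (sym e)))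

predecessor-< : {i j k : Fin n} → toℕ j ≡ suc (toℕ i) → k <ᶠ j → k ≢ i → k <ᶠ i
predecessor-< {k = k} j≡1+i k<j k≢i =
  ≤∧≢⇒< (≤-pred (subst (suc (toℕ k) ≤_) j≡1+i k<j)) (λ e → k≢i (toℕ-injective e))

module _ {i j : Fin n} where

  private
    σ : Fin n → Fin n
    σ = PC.transpose i j

  transpose-matchˡ : σ i ≡ j
  transpose-matchˡ with i ≟ᶠ i
  ... | yes _   = refl
  ... | no  i≢i = contradiction refl i≢i

  transpose-matchʳ : σ j ≡ i
  transpose-matchʳ with j ≟ᶠ i
  ... | yes j≡i = j≡i
  ... | no  _ with j ≟ᶠ j
  ...   | yes _   = refl
  ...   | no  j≢j = contradiction refl j≢j

  transpose-mismatch : {k : Fin n} → k ≢ i → k ≢ j → σ k ≡ k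
  transpose-mismatch {k} k≢i k≢j with k ≟ᶠ i
  ... | yes k≡i = contradiction k≡i k≢i
  ... | no  _ with k ≟ᶠ j
  ...   | yes k≡j = contradiction k≡j k≢j
  ...   | no  _   = refl

  data TransposeView (k : Fin n) : Set where
    at-i  : k ≡ i → TransposeView k
    at-j  : k ≡ j → TransposeView k
    elsewhere : k ≢ i → k ≢ j → TransposeView k

  transpose-view : (k : Fin n) → TransposeView k
  transpose-view k with k ≟ᶠ i | k ≟ᶠ j
  ... | yes k≡i | _       = at-i k≡i
  ... | no  _   | yes k≡j = at-j k≡j
  ... | no  k≢i | no  k≢j = elsewhere k≢i k≢j

  transpose-involutive : (k : Fin n) → σ (σ k) ≡ k
  transpose-involutive k with transpose-view k
  ... | at-i refl        = trans (cong σ transpose-matchˡ) transpose-matchʳ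
  ... | at-j refl        = trans (cong σ transpose-matchʳ) transpose-matchˡ
  ... | elsewhere k≢i k≢j    = trans (cong σ (transpose-mismatch k≢i k≢j)) (transpose-mismatch k≢i k≢j)

  module _ (j≡1+i : toℕ j ≡ suc (toℕ i)) where

    private
      i<j : i <ᶠ j
      i<j = ≤-reflexive (sym j≡1+i)

    transpose-<⁺ : {u v : Fin n} → u <ᶠ v → ¬ (u ≡ i × v ≡ j) → σ u <ᶠ σ v
    transpose-<⁺ {u} {v} u<v excl with transpose-view u | transpose-view v
    ... | at-i refl     | at-i refl     = contradiction u<v (<-irrefl refl)
    ... | at-i refl     | at-j refl     = contradiction (refl , refl) excl
    ... | at-i refl     | elsewhere v≢i v≢j =
      subst₂ _<ᶠ_ (sym transpose-matchˡ) (sym (transpose-mismatch v≢i v≢j)) (successor-< j≡1+i u<v v≢j)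
    ... | at-j refl     | at-i refl     = contradiction u<v (<-asym i<j)
    ... | at-j refl     | at-j refl     = contradiction u<v (<-irrefl refl)
    ... | at-j refl     | elsewhere v≢i v≢j =
      subst₂ _<ᶠ_ (sym transpose-matchʳ) (sym (transpose-mismatch v≢i v≢j)) (<-trans i<j u<v)
    ... | elsewhere u≢i u≢j | at-i refl     =
      subst₂ _<ᶠ_ (sym (transpose-mismatch u≢i u≢j)) (sym transpose-matchˡ) (<-trans u<v i<j)
    ... | elsewhere u≢i u≢j | at-j refl     =
      subst₂ _<ᶠ_ (sym (transpose-mismatch u≢i u≢j)) (sym transpose-matchʳ) (predecessor-< j≡1+i u<v u≢i)
    ... | elsewhere u≢i u≢j | elsewhere v≢i v≢j =
      subst₂ _<ᶠ_ (sym (transpose-mismatch u≢i u≢j)) (sym (transpose-mismatch v≢i v≢j)) u<v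

    transpose-<⁻ : {u v : Fin n} → σ u <ᶠ σ v → ¬ (u ≡ j × v ≡ i) → u <ᶠ v
    transpose-<⁻ {u} {v} σu<σv excl =
      subst₂ _<ᶠ_ (transpose-involutive u) (transpose-involutive v)
        (transpose-<⁺ σu<σv λ (σu≡i , σv≡j) → excl (unσ σu≡i transpose-matchˡ , unσ σv≡j transpose-matchʳ))
      where
      unσ : ∀ {k l m} → σ k ≡ l → σ l ≡ m → k ≡ m
      unσ {k} σk≡l σl≡m = trans (sym (transpose-involutive k)) (trans (cong σ σk≡l) σl≡m)

pos-injective : (w : Permutation′ n) {a b : Fin n} → pos w a ≡ pos w b → a ≡ b
pos-injective w {a} {b} e = begin
  a                  ≡⟨ sym (inverseʳ w) ⟩
  w ⟨$⟩ʳ (pos w a)   ≡⟨ cong (w ⟨$⟩ʳ_) e ⟩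
  w ⟨$⟩ʳ (pos w b)   ≡⟨ inverseʳ w ⟩
  b                  ∎
  where open ≡-Reasoning

InD-trans : (w : Permutation′ n) {a b c : Fin n} → InD w a b → InD w b c → InD w a c
InD-trans w (b<a , ab) (c<b , bc) = <-trans c<b b<a , <-trans ab bc

ArmCell LegCell : Permutation′ n → Labelling n → Fin n → Fin n → Pred (Fin n) 0ℓ
ArmCell w R p q q' = (q <ᶠ q') × InD w p q' × (R p q < R p q')
LegCell w R p q p' = (pos w p <ᶠ pos w p') × InD w p' q × (R p' q < R p q)

arm? : (w : Permutation′ n) (R : Labelling n) (p q : Fin n) → Decidable (ArmCell w R p q)
arm? w R p q q' = (q <ᶠ? q') ×-dec (InD? w p q' ×-dec (R p q <ℕ? R p q'))

leg? : (w : Permutation′ n) (R : Labelling n) (p q : Fin n) → Decidable (LegCell w R p q)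
leg? w R p q p' = (pos w p <ᶠ? pos w p') ×-dec (InD? w p' q ×-dec (R p' q <ℕ? R p q))

arm leg : Permutation′ n → Labelling n → Fin n → Fin n → ℕ
arm w R p q = count (arm? w R p q)
leg w R p q = count (leg? w R p q)

leg-adjacent≡0 : (w : Permutation′ n) (R : Labelling n) {p s : Fin n} →
  toℕ (pos w s) ≡ suc (toℕ (pos w p)) → leg w R p s ≡ 0
leg-adjacent≡0 w R {p} {s} s≡1+p = count-none (leg? w R p s) λ p' (p<p' , (_ , p'<s) , _) →
  <-irrefl refl (<-≤-trans p'<s (subst (_≤ toℕ (pos w p')) (sym s≡1+p) p<p'))

-- StandardBalanced without the range condition: exchanges shrink ℓ(w), so the labels are
-- bounded separately by LabelsAtMost.
record Balanced (w : Permutation′ n) (R : Labelling n) : Set where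
  field
    inj     : ∀ {p q p' q'} → InD w p q → InD w p' q' → R p q ≡ R p' q' → p ≡ p' × q ≡ q'
    balance : ∀ {p q} → InD w p q → arm w R p q ≡ leg w R p q

LabelsAtMost : Permutation′ n → Labelling n → ℕ → Set
LabelsAtMost w R B = ∀ {a b} → InD w a b → R a b ≤ B

standard⇒balanced : {w : Permutation′ n} {R : Labelling n} → StandardBalanced w R → Balanced w R
standard⇒balanced {w = w} {R} sb = record
  { inj     = λ {p} {q} {p'} {q'} → inj p q p' q'
  ; balance = λ {p} {q} pq → begin
      arm w R p q        ≡⟨ sym (length-filter-tabulate (arm? w R p q) (λ k → k)) ⟩
      armCount w R p q   ≡⟨ balance p q pq ⟩
      legCount w R p q   ≡⟨ length-filter-tabulate (leg? w R p q) (λ k → k) ⟩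
      leg w R p q        ∎
  }
  where
  open StandardBalanced sb
  open ≡-Reasoning

-- Interchanges the values p and q in the one-line notation of w: pos (exchange w p q) is
-- pos w followed by the transposition of pos w p and pos w q.
exchange : Permutation′ n → Fin n → Fin n → Permutation′ n
exchange w p q = transpose (pos w q) (pos w p) ∘ₚ w

module _ (w : Permutation′ n) {p q : Fin n} where

  pos-exchangeˡ : pos (exchange w p q) p ≡ pos w q
  pos-exchangeˡ = transpose-matchˡ {i = pos w p} {pos w q}

  pos-exchangeʳ : pos (exchange w p q) q ≡ pos w p
  pos-exchangeʳ = transpose-matchʳ {i = pos w p} {pos w q}

  pos-exchange-elsewhere : ∀ {a} → a ≢ p → a ≢ q → pos (exchange w p q) a ≡ pos w a
  pos-exchange-elsewhere a≢p a≢q = transpose-mismatch (a≢p ∘ pos-injective w) (a≢q ∘ pos-injective w)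

module _ (w : Permutation′ n) {p q : Fin n} (adj : toℕ (pos w q) ≡ suc (toℕ (pos w p))) where

  private
    w′ : Permutation′ n
    w′ = exchange w p q

  exchange-<⁺ : ∀ {a c} → pos w a <ᶠ pos w c → ¬ (a ≡ p × c ≡ q) → pos w′ a <ᶠ pos w′ c
  exchange-<⁺ lt excl =
    transpose-<⁺ adj lt λ (e₁ , e₂) → excl (pos-injective w e₁ , pos-injective w e₂)

  exchange-<⁻ : ∀ {a c} → pos w′ a <ᶠ pos w′ c → ¬ (a ≡ q × c ≡ p) → pos w a <ᶠ pos w c
  exchange-<⁻ lt excl =
    transpose-<⁻ adj lt λ (e₁ , e₂) → excl (pos-injective w e₁ , pos-injective w e₂)

  exchange-swaps : ¬ (pos w′ p <ᶠ pos w′ q)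
  exchange-swaps lt = <-asym (subst₂ _<ᶠ_ (pos-exchangeˡ w) (pos-exchangeʳ w) lt) (≤-reflexive (sym adj))

  InD-exchange⁺ : ∀ {a b} → InD w a b → ¬ (a ≡ p × b ≡ q) → InD w′ a b
  InD-exchange⁺ (b<a , lt) excl = b<a , exchange-<⁺ lt excl

  InD-exchange⁻ : q <ᶠ p → ∀ {a b} → InD w′ a b → InD w a b × ¬ (a ≡ p × b ≡ q)
  InD-exchange⁻ q<p (b<a , lt) =
    (b<a , exchange-<⁻ lt λ { (refl , refl) → <-asym b<a q<p }) , λ { (refl , refl) → exchange-swaps lt }

module TopCell {w : Permutation′ n} {R : Labelling n} (B : Balanced w R)
               {p q : Fin n} (pq : InD w p q) (top : LabelsAtMost w R (R p q)) where

  open Balanced B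

  label-< : ∀ {a b} → InD w a b → ¬ (a ≡ p × b ≡ q) → R a b < R p q
  label-< ab excl = ≤∧≢⇒< (top ab) λ e → excl (inj ab pq e)

  arm≡0 : arm w R p q ≡ 0
  arm≡0 = count-none (arm? w R p q) λ _ (_ , pq' , lt) → <-irrefl refl (<-≤-trans lt (top pq'))

  pos-adjacent : toℕ (pos w q) ≡ suc (toℕ (pos w p))
  -- s is the value right after p in w.  If q < s then s is a leg cell of (p , q), whose arm is
  -- empty; if s < q then (p , s) is a cell with arm cell q but no leg cell.
  pos-adjacent = by-cases (<ᶠ-cmp s q)
    where
    s : Fin n
    s = w ⟨$⟩ʳ fromℕ< (≤-<-trans (proj₂ pq) (toℕ<n (pos w q)))

    s≡1+p : toℕ (pos w s) ≡ suc (toℕ (pos w p))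
    s≡1+p = trans (cong toℕ (inverseˡ w)) (toℕ-fromℕ< _)

    p<s : pos w p <ᶠ pos w s
    p<s = ≤-reflexive (sym s≡1+p)

    by-cases : Tri (s <ᶠ q) (s ≡ q) (q <ᶠ s) → toℕ (pos w q) ≡ suc (toℕ (pos w p))
    by-cases (tri≈ _ s≡q _)  = subst (λ c → toℕ (pos w c) ≡ suc (toℕ (pos w p))) s≡q s≡1+p
    by-cases (tri> _ _ q<s)  = contradiction (trans (sym (balance pq)) arm≡0) (≢-sym (<⇒≢ leg>0))
      where
      sq : InD w s q
      sq = q<s , ≤∧≢⇒< (subst (_≤ toℕ (pos w q)) (sym s≡1+p) (proj₂ pq))
                        (λ e → <ᶠ⇒≢ q<s (sym (pos-injective w (toℕ-injective e))))
      leg>0 : 0 < leg w R p q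
      leg>0 = count-some (leg? w R p q) {s}
        (p<s , sq , label-< sq λ (s≡p , _) → <-irrefl (cong (λ c → toℕ (pos w c)) (sym s≡p)) p<s)
    by-cases (tri< s<q _ _)  = contradiction (trans (balance ps) (leg-adjacent≡0 w R s≡1+p)) (≢-sym (<⇒≢ arm>0))
      where
      ps : InD w p s
      ps = <-trans s<q (proj₁ pq) , p<s
      arm>0 : 0 < arm w R p s
      arm>0 = count-some (arm? w R p s) {q} (s<q , pq , label-< ps λ (_ , s≡q) → <ᶠ⇒≢ s<q s≡q)

  row-labels-< : ∀ {b} → InD w q b → R q b < R p b
  -- If R p b < R q b, the arm of (p , b) contains that of (q , b) and also q, while its leg is
  -- contained in that of (q , b).
  row-labels-< = go (>-wellFounded _)
    where
    go : ∀ {b} → Acc _>ᶠ_ b → InD w q b → R q b < R p b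
    go {b} (acc smaller) qb = decidable-stable (R q b <ℕ? R p b) λ q≮p →
      <-irrefl refl (<-≤-trans (arm-< (flip q≮p)) (arm-≤ (flip q≮p)))
      where
      pb : InD w p b
      pb = InD-trans w pq qb

      flip : ¬ (R q b < R p b) → R p b < R q b
      flip q≮p = ≤∧≢⇒< (≮⇒≥ q≮p) λ e → <ᶠ⇒≢ (proj₁ pq) (sym (proj₁ (inj pb qb e)))

      arm-< : R p b < R q b → arm w R q b < arm w R p b
      arm-< p<q = count-< (arm? w R q b) (arm? w R p b) {q}
        (λ (b<q' , qq' , lt) → b<q' , InD-trans w pq qq' , <-trans p<q (<-trans lt (go (smaller b<q') qq')))
        (proj₁ qb , pq , label-< pb λ (_ , b≡q) → <ᶠ⇒≢ (proj₁ qb) b≡q)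
        (λ (_ , (q<q , _) , _) → <-irrefl refl q<q)

      arm-≤ : R p b < R q b → arm w R p b ≤ arm w R q b
      arm-≤ p<q = begin
        arm w R p b  ≡⟨ balance pb ⟩
        leg w R p b  ≤⟨ count-mono (leg? w R p b) (leg? w R q b) below-q ⟩
        leg w R q b  ≡⟨ sym (balance qb) ⟩
        arm w R q b  ∎
        where
        open ≤-Reasoning
        below-q : ∀ {p'} → LegCell w R p b p' → LegCell w R q b p'
        below-q (p<p' , p'b , lt) =
          successor-< pos-adjacent p<p'
            (λ e → <-asym p<q (subst (λ c → R c b < R p b) (pos-injective w e) lt)) ,
          p'b , <-trans lt p<q

module Exchange {w : Permutation′ n} {R : Labelling n} (B : Balanced w R)
                {p q : Fin n} (pq : InD w p q) (top : LabelsAtMost w R (R p q)) where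

  open Balanced B
  open TopCell B pq top public

  w′ : Permutation′ n
  w′ = exchange w p q

  InD⁺ : ∀ {a b} → InD w a b → ¬ (a ≡ p × b ≡ q) → InD w′ a b
  InD⁺ = InD-exchange⁺ w pos-adjacent

  InD⁻ : ∀ {a b} → InD w′ a b → InD w a b × ¬ (a ≡ p × b ≡ q)
  InD⁻ = InD-exchange⁻ w pos-adjacent (proj₁ pq)

  labels-< : ∀ {a b} → InD w′ a b → R a b < R p q
  labels-< ab = label-< (proj₁ (InD⁻ ab)) (proj₂ (InD⁻ ab))

  labels-≤ : ∀ {L} → R p q ≡ suc L → LabelsAtMost w′ R L
  labels-≤ Rpq≡1+L {a} {b} ab = ≤-pred (subst (R a b <_) Rpq≡1+L (labels-< ab))

  arm-exchange : ∀ {a b} → ¬ (a ≡ p × b <ᶠ q) → arm w R a b ≡ arm w′ R a b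
  arm-exchange {a} {b} excl = count-cong (arm? w R a b) (arm? w′ R a b)
    ( (λ (b<q' , aq' , lt) → b<q' , InD⁺ aq' (λ { (a≡p , refl) → excl (a≡p , b<q') }) , lt)
    , (λ (b<q' , aq' , lt) → b<q' , proj₁ (InD⁻ aq') , lt) )

  arm-exchange-suc : ∀ {b} → InD w p b → b <ᶠ q → arm w R p b ≡ suc (arm w′ R p b)
  arm-exchange-suc {b} pb b<q = count-suc (arm? w′ R p b) (arm? w R p b) {q}
    (λ (b<q' , pq' , lt) → b<q' , proj₁ (InD⁻ pq') , lt)
    (b<q , pq , label-< pb λ (_ , b≡q) → <ᶠ⇒≢ b<q b≡q)
    (λ (_ , pq′ , _) → proj₂ (InD⁻ pq′) (refl , refl))
    (λ (b<q' , pq' , lt) q'≢q → b<q' , InD⁺ pq' (λ (_ , q'≡q) → q'≢q q'≡q) , lt)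

  leg-cell⁺ : ∀ {a b p'} → InD w a b → ¬ (a ≡ p × p' ≡ q) →
    LegCell w R a b p' → LegCell w′ R a b p'
  leg-cell⁺ ab excl (a<p' , p'b , lt) =
    exchange-<⁺ w pos-adjacent a<p' excl ,
    InD⁺ p'b (λ { (refl , refl) → <-irrefl refl (<-≤-trans lt (top ab)) }) ,
    lt

  leg-cell⁻ : ∀ {a b p'} → InD w a b → LegCell w′ R a b p' → LegCell w R a b p'
  leg-cell⁻ ab (a<p' , p'b , lt) =
    exchange-<⁻ w pos-adjacent a<p' (λ { (refl , refl) → <-asym lt (row-labels-< ab) }) ,
    proj₁ (InD⁻ p'b) ,
    lt

  leg-exchange : ∀ {a b} → InD w a b → ¬ (a ≡ p × b <ᶠ q) → leg w R a b ≡ leg w′ R a b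
  leg-exchange {a} {b} ab excl = count-cong (leg? w R a b) (leg? w′ R a b)
    ( (λ c → leg-cell⁺ ab (λ { (a≡p , refl) → excl (a≡p , proj₁ (proj₁ (proj₂ c))) }) c)
    , leg-cell⁻ ab )

  leg-exchange-suc : ∀ {b} → InD w p b → b <ᶠ q → leg w R p b ≡ suc (leg w′ R p b)
  leg-exchange-suc {b} pb b<q = count-suc (leg? w′ R p b) (leg? w R p b) {q}
    (leg-cell⁻ pb)
    (proj₂ pq , qb , row-labels-< qb)
    (λ (p<q , _) → exchange-swaps w pos-adjacent p<q)
    (λ c q'≢q → leg-cell⁺ pb (λ (_ , e) → q'≢q e) c)
    where
    qb : InD w q b
    qb = b<q , successor-< pos-adjacent (proj₂ pb) (λ e → <ᶠ⇒≢ b<q (pos-injective w e))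

  balanced : Balanced w′ R
  balanced = record
    { inj     = λ ab a'b' → inj (proj₁ (InD⁻ ab)) (proj₁ (InD⁻ a'b'))
    ; balance = λ {a} {b} ab → by-cases (proj₁ (InD⁻ ab)) ((a ≟ᶠ p) ×-dec (b <ᶠ? q))
    }
    where
    open ≡-Reasoning
    by-cases : ∀ {a b} → InD w a b → Dec (a ≡ p × b <ᶠ q) → arm w′ R a b ≡ leg w′ R a b
    by-cases {b = b} pb (yes (refl , b<q)) = ℕ-suc-injective (begin
      suc (arm w′ R p b)  ≡⟨ sym (arm-exchange-suc pb b<q) ⟩
      arm w R p b         ≡⟨ balance pb ⟩
      leg w R p b         ≡⟨ leg-exchange-suc pb b<q ⟩
      suc (leg w′ R p b)  ∎)
    by-cases {a} {b} ab (no excl) = begin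
      arm w′ R a b  ≡⟨ sym (arm-exchange excl) ⟩
      arm w R a b   ≡⟨ balance ab ⟩
      leg w R a b   ≡⟨ leg-exchange ab excl ⟩
      leg w′ R a b  ∎

record Truncation (w : Permutation′ n) (R : Labelling n) (k : ℕ) : Set where
  field
    perm     : Permutation′ n
    balanced : Balanced perm R
    bounded  : LabelsAtMost perm R k
    keeps    : ∀ {a b} → InD w a b → R a b ≤ k → InD perm a b

truncation-refl : {w : Permutation′ n} {R : Labelling n} {k : ℕ} →
  Balanced w R → LabelsAtMost w R k → Truncation w R k
truncation-refl {w = w} bal bnd = record { perm = w ; balanced = bal ; bounded = bnd ; keeps = λ ab _ → ab }

truncation-pred : {w : Permutation′ n} {R : Labelling n} {B : ℕ} →
  Balanced w R → LabelsAtMost w R (suc B) → Truncation w R B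
truncation-pred {w = w} {R} {B} bal bnd with any? (λ a → any? (λ b → InD? w a b ×-dec (R a b ≟ suc B)))
... | yes (p , q , pq , R≡1+B) = record
  { perm     = E.w′
  ; balanced = E.balanced
  ; bounded  = E.labels-≤ R≡1+B
  ; keeps    = λ ab ≤B → E.InD⁺ ab λ { (refl , refl) → <-irrefl refl (subst (_≤ B) R≡1+B ≤B) }
  }
  where
  module E = Exchange bal pq (subst (LabelsAtMost w R) (sym R≡1+B) bnd)
... | no none = truncation-refl bal λ ab → ≤-pred (≤∧≢⇒< (bnd ab) λ e → none (_ , _ , ab , e))

truncation : {w : Permutation′ n} {R : Labelling n} {B k : ℕ} →
  Balanced w R → LabelsAtMost w R B → k ≤ B → Truncation w R k
truncation {B = zero}  bal bnd z≤n = truncation-refl bal bnd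
truncation {B = suc B} {k} bal bnd k≤1+B with m≤n⇒m<n∨m≡n k≤1+B
... | inj₂ refl  = truncation-refl bal bnd
... | inj₁ k<1+B = record
  { perm     = T′.perm
  ; balanced = T′.balanced
  ; bounded  = T′.bounded
  ; keeps    = λ ab ≤k → T′.keeps (T.keeps ab (≤-trans ≤k (≤-pred k<1+B))) ≤k
  }
  where
  module T  = Truncation (truncation-pred bal bnd)
  module T′ = Truncation (truncation T.balanced T.bounded (≤-pred k<1+B))

top-hook-impossible : {w : Permutation′ n} {R : Labelling n} → Balanced w R →
  ∀ {i} → LabelsAtMost w R (suc (suc i)) →
  ∀ {x y z y'} → x <ᶠ y → InD w z y → InD w z x → InD w y' x →
  R z y ≡ i → R z x ≡ suc i → R y' x ≡ suc (suc i) → y' ≢ y → ⊥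
top-hook-impossible {w = w} {R} B {i} bnd {x} {y} {z} {y'} x<y zy zx y'x Rzy Rzx Ry'x y'≢y =
  <ᶠ⇒≢ x<y (sym (pos-injective w (toℕ-injective pos-y≡pos-x)))
  where
  module E₁ = Exchange B y'x (subst (LabelsAtMost w R) (sym Ry'x) bnd)

  z≢y' : z ≢ y'
  z≢y' refl = <-irrefl (trans (sym Rzx) Ry'x) (n<1+n (suc i))

  zx₁ : InD E₁.w′ z x
  zx₁ = E₁.InD⁺ zx λ (z≡y' , _) → z≢y' z≡y'

  zy₁ : InD E₁.w′ z y
  zy₁ = E₁.InD⁺ zy λ (z≡y' , _) → z≢y' z≡y'

  module E₂ = Exchange E₁.balanced zx₁
    (subst (LabelsAtMost E₁.w′ R) (sym Rzx) (E₁.labels-≤ Ry'x))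

  y≢x : y ≢ x
  y≢x y≡x = <ᶠ⇒≢ x<y (sym y≡x)

  zy₂ : InD E₂.w′ z y
  zy₂ = E₂.InD⁺ zy₁ λ (_ , y≡x) → y≢x y≡x

  module M₃ = TopCell E₂.balanced zy₂
    (subst (LabelsAtMost E₂.w′ R) (sym Rzy) (E₂.labels-≤ Rzx))

  pos-y≡pos-x : toℕ (pos w y) ≡ toℕ (pos w x)
  pos-y≡pos-x = begin
    toℕ (pos w y)              ≡⟨ cong toℕ (sym (pos-exchange-elsewhere w (≢-sym y'≢y) y≢x)) ⟩
    toℕ (pos E₁.w′ y)          ≡⟨ cong toℕ (sym (pos-exchange-elsewhere E₁.w′ (<ᶠ⇒≢ (proj₁ zy)) y≢x)) ⟩
    toℕ (pos E₂.w′ y)          ≡⟨ M₃.pos-adjacent ⟩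
    suc (toℕ (pos E₂.w′ z))    ≡⟨ cong (suc ∘ toℕ) (pos-exchangeˡ E₁.w′) ⟩
    suc (toℕ (pos E₁.w′ x))    ≡⟨ cong (suc ∘ toℕ) (pos-exchangeʳ w) ⟩
    suc (toℕ (pos w y'))       ≡⟨ sym E₁.pos-adjacent ⟩
    toℕ (pos w x)              ∎
    where open ≡-Reasoning

mainTheorem7 : (n : ℕ) → 2 ≤ n → (w : Permutation′ n) → (R : Labelling n) →
    StandardBalanced w R → (x y z : Fin n) → x <ᶠ y → y <ᶠ z →
    InD w z y → InD w z x → (i : ℕ) → R z y ≡ i → R z x ≡ suc i →
    (y' : Fin n) → y' ≢ y → ¬ (InD w y' x × R y' x ≡ suc (suc i))
mainTheorem7 _ _ w R sb x y z x<y _ zy zx i Rzy Rzx y' y'≢y (y'x , Ry'x) =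
  top-hook-impossible T.balanced T.bounded x<y
    (T.keeps zy (subst (_≤ suc (suc i)) (sym Rzy) (≤-trans (n≤1+n i) (n≤1+n (suc i)))))
    (T.keeps zx (subst (_≤ suc (suc i)) (sym Rzx) (n≤1+n (suc i))))
    (T.keeps y'x (≤-reflexive Ry'x))
    Rzy Rzx Ry'x y'≢y
  where
  open StandardBalanced sb using (range)
  module T = Truncation (truncation (standard⇒balanced sb) (λ ab → proj₂ (range _ _ ab))
                                    (subst (_≤ len w) Ry'x (proj₂ (range y' x y'x))))
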